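{- Let $n\ge 2$, $r\in[n+1]$, and let $\pi\in S_n$ be $r$-toppleable. Consider any run of the toppling process starting from $\pi^{(r)}$. Then: (1) for each $1\le k\le\lfloor n/2\rfloor+1$, the last move made by chip $k$ is to the left; (2) for each $\lfloor n/2\rfloor+2\le k\le n+1$, the last move made by chip $k$ is to the right; (3) the last toppling move of the process topples chips $\lfloor n/2\rfloor+1$ and $\lfloor n/2\rfloor+2$ into the positions they occupy in the final configuration.
   Context: For an integer $n\ge 2$ let $L_n=\{ -\lfloor (n+1)/2\rfloor,\dots,\lfloor n/2\rfloor+1\}\subset\mathbb{Z}$; position $0$ is the origin. A toppling move chooses a position $i$ holding at least two chips, chooses two chips $\alpha<\beta$ at $i$, and moves $\alpha$ to $i-1$ and $\beta$ to $i+1$; the toppling process applies such moves (arbitrary choices) until no position holds two or more chips. For $\pi\in S_n$ and $r\in[n+1]$, the initial configuration $\pi^{(r)}$ has, for $j=1,\dots,n$, one chip at position $-\lfloor (n-1)/2\rfloor+j-1$ labeled $\pi_j$ if $\pi_j<r$ and $\pi_j+1$ if $\pi_j\ge r$, plus a chip labeled $r$ at the origin. The final configuration does not depend on the choices and has at most one chip per position; reading chips left to right gives $\mathcal{T}(\pi,r)\in S_{n+1}$. $\pi$ is $r$-toppleable if $\mathcal{T}(\pi,r)$ is the identity permutation. -}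

module Defs where

open import Data.Nat using (ℕ; zero; suc; _+_; _∸_; _<_; _<ᵇ_; _/_)
open import Data.Integer as ℤ using (ℤ; +_; -_)
open import Data.Fin using (Fin; toℕ; _≟_)
open import Data.Fin.Permutation using (Permutation′; _⟨$⟩ʳ_)
open import Data.Vec.Functional using (Vector) renaming (_∷_ to _∷ᵥ_)
open import Data.Product using (_×_; _,_; proj₁; proj₂; Σ; ∃)
open import Data.List using (List; []; _∷_; _++_; [_])
open import Data.List.Relation.Unary.All using (All)
open import Data.Bool using (if_then_else_)
open import Relation.Nullary using (¬_; yes; no)
open import Relation.Binary.PropositionalEquality using (_≡_; _≢_)

Chip : Set
Chip = ℕ × ℤ

label : Chip → ℕ
label = proj₁

pos : Chip → ℤ
pos = proj₂

-- A configuration of m chips: the chips are indexed by Fin m (the index is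
-- only bookkeeping; the chip's identity is its label, which never changes).
Config : ℕ → Set
Config m = Vector Chip m

Move : ℕ → Set
Move m = Fin m × Fin m

Valid : ∀ {m} → Config m → Move m → Set
Valid c (p , q) = label (c p) < label (c q) × pos (c p) ≡ pos (c q)

apply : ∀ {m} → Config m → Move m → Config m
apply c (p , q) x with x ≟ p | x ≟ q
... | yes _ | _     = label (c x) , pos (c x) ℤ.- + 1
... | no _  | yes _ = label (c x) , pos (c x) ℤ.+ + 1
... | no _  | no _  = c x

exec : ∀ {m} → Config m → List (Move m) → Config m
exec c []        = c
exec c (mv ∷ ms) = exec (apply c mv) ms

data Run {m} : Config m → List (Move m) → Set where
  done : ∀ {c} → Run c []
  step : ∀ {c mv ms} → Valid c mv → Run (apply c mv) ms → Run c (mv ∷ ms)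

Stable : ∀ {m} → Config m → Set
Stable c = ∀ i j → i ≢ j → pos (c i) ≢ pos (c j)

-- Reading the chips left to right gives the identity permutation
-- (labels are 1..m, so this means positions increase with labels).
ReadsIdentity : ∀ {m} → Config m → Set
ReadsIdentity c = ∀ i j → label (c i) < label (c j) → pos (c i) ℤ.< pos (c j)

-- The initial configuration π^(r) (n chips from π, plus chip r at the origin).
-- π_j (1-indexed value) = suc (toℕ (π ⟨$⟩ʳ j)); the j-th chip (j 0-indexed)
-- sits at -⌊(n-1)/2⌋ + j.
relabel : ℕ → ℕ → ℕ
relabel r v = if v <ᵇ r then v else suc v

initial : (n : ℕ) → Permutation′ n → ℕ → Config (suc n)
initial n π r = (r , + 0) ∷ᵥ λ j →
  relabel r (suc (toℕ (π ⟨$⟩ʳ j))) , (- (+ ((n ∸ 1) / 2))) ℤ.+ + toℕ j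

-- π is r-toppleable: the final configuration of the toppling process from
-- π^(r) reads as the identity (the final configuration is independent of
-- the run, so we ask for a complete run with this property).
Toppleable : (n : ℕ) → Permutation′ n → ℕ → Set
Toppleable n π r = Σ (List (Move (suc n))) λ ms →
  Run (initial n π r) ms × Stable (exec (initial n π r) ms)
    × ReadsIdentity (exec (initial n π r) ms)

Avoids : ∀ {m} → Fin m → Move m → Set
Avoids i (p , q) = p ≢ i × q ≢ i

LastMoveLeft : ∀ {m} → Fin m → List (Move m) → Set
LastMoveLeft {m} i ms = Σ (List (Move m)) λ xs → Σ (Fin m) λ q → Σ (List (Move m)) λ ys →
  ms ≡ xs ++ ((i , q) ∷ ys) × All (Avoids i) ys

LastMoveRight : ∀ {m} → Fin m → List (Move m) → Set
LastMoveRight {m} i ms = Σ (List (Move m)) λ xs → Σ (Fin m) λ p → Σ (List (Move m)) λ ys →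
  ms ≡ xs ++ ((p , i) ∷ ys) × All (Avoids i) ys

module Submission where

-- Number the sites so that the chips of π start on sites 1 … n.  Along any
-- run every chip stays on sites 0 … n + 1 and the sites left of any j hold
-- j or j − 1 chips; this pins down each toppling and makes distinct legal
-- moves disjoint, so the process is confluent and the final configuration F
-- reads the identity.  F leaves exactly one site h empty, and the conserved
-- potential Σ_j #left_j places it at ⌊n/2⌋ + 1; the chips left of h carry
-- labels 1 … h, the others h + 1 … n + 1.  Every chip moves.  A chip whose
-- last move is to the left, onto site k, keeps k + 1 chips on sites ≤ k from
-- then on, so h lies to its right; symmetrically for moves to the right.  The
-- last move empties site h, sending its two chips to h − 1 and h + 1, where
-- they are labelled h and h + 1.

open import Defs
open import Data.Bool using (Bool; true; false; T)
open import Data.Unit using (tt)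
open import Data.Empty using (⊥; ⊥-elim)
open import Data.Sum using (_⊎_; inj₁; inj₂)
open import Data.Fin using (Fin; zero; suc; toℕ; _≟_)
open import Data.Fin.Permutation using (Permutation′; _⟨$⟩ʳ_; _⟨$⟩ˡ_; inverseˡ)
open import Data.Fin.Properties using (toℕ-injective; toℕ<n)
import Data.Fin.Properties as FinP
open import Data.Nat using (ℕ; zero; suc; _+_; _∸_; _⊓_; _/_; _≤_; _<_; _<ᵇ_; z≤n; s≤s)
open import Data.Nat.DivMod using (m/n≡1+[m∸n]/n; m/n≤m)
open import Data.Nat.Properties renaming (_≟_ to _≟ℕ_)
open import Data.Integer as ℤ using (ℤ; +_; -_)
import Data.Integer.Properties as ℤP
import Data.Integer.Tactic.RingSolver as ℤSolver
open import Data.Nat.Tactic.RingSolver using (solve-∀)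
open import Data.List using (List; []; _∷_; _++_; [_]; length; initLast; _∷ʳ′_)
open import Data.List.Relation.Unary.All using (All; []; _∷_; all?)
open import Data.Product using (_×_; _,_; proj₁; proj₂; Σ; ∃-syntax)
open import Data.Product.Properties using (≡-dec)
open import Data.List.Properties using (length-++-sucʳ)
open import Data.Vec.Functional using (updateAt)
open import Data.Vec.Functional.Properties using (updateAt-updates; updateAt-minimal)
open import Function using (_∘_; const; case_of_)
open import Relation.Binary.PropositionalEquality hiding ([_]; J)
open import Relation.Nullary using (¬_; yes; no; does; Dec)
open import Relation.Nullary.Decidable using (dec-true; dec-false)
open import Relation.Binary.Definitions using (Tri; tri<; tri≈; tri>)
-- Counting indices

bit : Bool → ℕ
bit true  = 1
bit false = 0

count : ∀ {m} → (Fin m → Bool) → ℕ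
count {zero}  P = 0
count {suc m} P = bit (P zero) + count (P ∘ suc)

_⊆ᵇ_ : ∀ {m} → (Fin m → Bool) → (Fin m → Bool) → Set
P ⊆ᵇ Q = ∀ i → P i ≡ true → Q i ≡ true

count-cong : ∀ {m} {P Q : Fin m → Bool} → (∀ i → P i ≡ Q i) → count P ≡ count Q
count-cong {zero}  e = refl
count-cong {suc m} e = cong₂ _+_ (cong bit (e zero)) (count-cong (e ∘ suc))

count-≤ : ∀ {m} (P : Fin m → Bool) → count P ≤ m
count-≤ {zero}  P = z≤n
count-≤ {suc m} P with P zero
... | true  = s≤s (count-≤ (P ∘ suc))
... | false = ≤-trans (count-≤ (P ∘ suc)) (n≤1+n m)

count-mono : ∀ {m} {P Q : Fin m → Bool} → P ⊆ᵇ Q → count P ≤ count Q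
count-mono {zero}  P⊆Q = z≤n
count-mono {suc m} P⊆Q = +-mono-≤ (bit-mono (P⊆Q zero)) (count-mono (P⊆Q ∘ suc))
  where
  bit-mono : ∀ {a b} → (a ≡ true → b ≡ true) → bit a ≤ bit b
  bit-mono {true}  a⇒b rewrite a⇒b refl = ≤-refl
  bit-mono {false} a⇒b = z≤n

count-update : ∀ {m} (P Q : Fin m → Bool) p → (∀ i → i ≢ p → P i ≡ Q i) →
  count P + bit (Q p) ≡ count Q + bit (P p)
count-update {suc m} P Q zero P≈Q
  rewrite count-cong {P = P ∘ suc} {Q ∘ suc} (λ i → P≈Q (suc i) λ ())
  = swap (bit (P zero)) (count (Q ∘ suc)) (bit (Q zero))
  where
  swap : ∀ a c b → a + c + b ≡ b + c + a
  swap = solve-∀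
count-update {suc m} P Q (suc p) P≈Q rewrite P≈Q zero (λ ()) = begin
  bit (Q zero) + count (P ∘ suc) + bit (Q (suc p))   ≡⟨ +-assoc (bit (Q zero)) _ _ ⟩
  bit (Q zero) + (count (P ∘ suc) + bit (Q (suc p))) ≡⟨ cong (λ x → bit (Q zero) + x) rec ⟩
  bit (Q zero) + (count (Q ∘ suc) + bit (P (suc p))) ≡⟨ +-assoc (bit (Q zero)) _ _ ⟨
  bit (Q zero) + count (Q ∘ suc) + bit (P (suc p))   ∎
  where
  open ≡-Reasoning
  rec = count-update (P ∘ suc) (Q ∘ suc) p (λ i i≢p → P≈Q (suc i) (i≢p ∘ FinP.suc-injective))

count-update₂ : ∀ {m} (P Q : Fin m → Bool) p q → p ≢ q → (∀ i → i ≢ p → i ≢ q → P i ≡ Q i) →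
  count P + bit (Q p) + bit (Q q) ≡ count Q + bit (P p) + bit (P q)
count-update₂ P Q p q p≢q P≈Q = begin
  count P + bit (Q p) + bit (Q q)   ≡⟨ cong (λ b → count P + bit b + bit (Q q)) (updateAt-updates p P) ⟨
  count P + bit (R p) + bit (Q q)   ≡⟨ cong (_+ bit (Q q)) (count-update P R p P≈R) ⟩
  count R + bit (P p) + bit (Q q)   ≡⟨ swap (count R) (bit (P p)) (bit (Q q)) ⟩
  count R + bit (Q q) + bit (P p)   ≡⟨ cong (_+ bit (P p)) (count-update R Q q R≈Q) ⟩
  count Q + bit (R q) + bit (P p)   ≡⟨ cong (λ b → count Q + bit b + bit (P p)) (updateAt-minimal q p P (p≢q ∘ sym)) ⟩
  count Q + bit (P q) + bit (P p)   ≡⟨ swap (count Q) (bit (P q)) (bit (P p)) ⟩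
  count Q + bit (P p) + bit (P q)   ∎
  where
  open ≡-Reasoning
  swap : ∀ a b c → a + b + c ≡ a + c + b
  swap = solve-∀
  R : Fin _ → Bool
  R = updateAt P p (const (Q p))
  P≈R : ∀ i → i ≢ p → P i ≡ R i
  P≈R i i≢p = sym (updateAt-minimal i p P i≢p)
  R≈Q : ∀ i → i ≢ q → R i ≡ Q i
  R≈Q i i≢q with i ≟ p
  ... | yes refl = updateAt-updates i P
  ... | no i≢p   = trans (updateAt-minimal i p P i≢p) (P≈Q i i≢p i≢q)

count-witness : ∀ {m} (P Q : Fin m → Bool) → count P < count Q → ∃[ i ] (P i ≡ false × Q i ≡ true)
count-witness {suc m} P Q lt with P zero in eP | Q zero in eQ
... | false | true  = zero , eP , eQ
... | true  | true  = let i , w = count-witness (P ∘ suc) (Q ∘ suc) (≤-pred lt) in suc i , w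
... | false | false = let i , w = count-witness (P ∘ suc) (Q ∘ suc) lt in suc i , w
... | true  | false = let i , w = count-witness (P ∘ suc) (Q ∘ suc) (<-trans (n<1+n _) lt) in suc i , w

insert : ∀ {m} → (Fin m → Bool) → Fin m → Fin m → Bool
insert P p = updateAt P p (const true)

count-insert : ∀ {m} (P : Fin m → Bool) p → P p ≡ false → count (insert P p) ≡ suc (count P)
count-insert P p Pp≡false = begin
  count (insert P p)                  ≡⟨ +-identityʳ _ ⟨
  count (insert P p) + 0              ≡⟨ cong (λ b → count (insert P p) + bit b) Pp≡false ⟨
  count (insert P p) + bit (P p)      ≡⟨ count-update P (insert P p) p (λ i i≢p → sym (updateAt-minimal i p P i≢p)) ⟨
  count P + bit (insert P p p)        ≡⟨ cong (λ b → count P + bit b) (updateAt-updates p P) ⟩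
  count P + 1                         ≡⟨ +-comm (count P) 1 ⟩
  suc (count P)                       ∎
  where open ≡-Reasoning

insert-⊆ : ∀ {m} {P Q : Fin m → Bool} {p} → P ⊆ᵇ Q → Q p ≡ true → insert P p ⊆ᵇ Q
insert-⊆ {P = P} {p = p} P⊆Q Qp i Pi with i ≟ p
... | yes refl = Qp
... | no i≢p   = P⊆Q i (trans (sym (updateAt-minimal i p P i≢p)) Pi)

insert-false : ∀ {m} {P : Fin m → Bool} {p i} → i ≢ p → P i ≡ false → insert P p i ≡ false
insert-false {P = P} {p} {i} i≢p Pi = trans (updateAt-minimal i p P i≢p) Pi

count-gain : ∀ {m} {P Q : Fin m → Bool} p → P ⊆ᵇ Q → P p ≡ false → Q p ≡ true →
  suc (count P) ≤ count Q
count-gain {P = P} p P⊆Q Pp Qp =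
  subst (_≤ _) (count-insert P p Pp) (count-mono (insert-⊆ P⊆Q Qp))

count-gain₂ : ∀ {m} {P Q : Fin m → Bool} p q → p ≢ q → P ⊆ᵇ Q →
  P p ≡ false → Q p ≡ true → P q ≡ false → Q q ≡ true → 2 + count P ≤ count Q
count-gain₂ {P = P} p q p≢q P⊆Q Pp Qp Pq Qq =
  subst (λ c → suc c ≤ _) (count-insert P p Pp)
    (count-gain q (insert-⊆ P⊆Q Qp) (insert-false (p≢q ∘ sym) Pq) Qq)

count-gain₃ : ∀ {m} {P Q : Fin m → Bool} p q r → p ≢ q → p ≢ r → q ≢ r → P ⊆ᵇ Q →
  P p ≡ false → Q p ≡ true → P q ≡ false → Q q ≡ true → P r ≡ false → Q r ≡ true →
  3 + count P ≤ count Q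
count-gain₃ {P = P} p q r p≢q p≢r q≢r P⊆Q Pp Qp Pq Qq Pr Qr =
  subst (λ c → 2 + c ≤ _) (count-insert P p Pp)
    (count-gain₂ q r q≢r (insert-⊆ P⊆Q Qp)
      (insert-false (p≢q ∘ sym) Pq) Qq (insert-false (p≢r ∘ sym) Pr) Qr)

count-witness₂ : ∀ {m} (P Q : Fin m → Bool) → P ⊆ᵇ Q → 2 + count P ≤ count Q →
  ∃[ i ] ∃[ j ] (i ≢ j × P i ≡ false × Q i ≡ true × P j ≡ false × Q j ≡ true)
count-witness₂ P Q P⊆Q lt with count-witness P Q (≤-trans (n≤1+n _) lt)
... | i , Pi , Qi with count-witness (insert P i) Q (subst (_< count Q) (sym (count-insert P i Pi)) lt)
...   | j , Pj , Qj with j ≟ i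
...     | yes refl = case trans (sym (updateAt-updates i P)) Pj of λ ()
...     | no j≢i = i , j , j≢i ∘ sym , Pi , Qi , trans (sym (updateAt-minimal j i P j≢i)) Pj , Qj

count-false : ∀ n → count {n} (const false) ≡ 0
count-false zero    = refl
count-false (suc n) = count-false n

count-toℕ< : ∀ n j → count {n} (λ t → toℕ t <ᵇ j) ≡ n ⊓ j
count-toℕ< zero    j       = refl
count-toℕ< (suc n) zero    = count-false n
count-toℕ< (suc n) (suc j) = cong suc (count-toℕ< n j)

<ᵇ-true : ∀ {a b} → a < b → (a <ᵇ b) ≡ true
<ᵇ-true {a} {b} = dec-true (a <? b)

<ᵇ-false : ∀ {a b} → ¬ a < b → (a <ᵇ b) ≡ false
<ᵇ-false {a} {b} = dec-false (a <? b)

<ᵇ-true⁻ : ∀ {a b} → (a <ᵇ b) ≡ true → a < b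
<ᵇ-true⁻ {a} {b} e = <ᵇ⇒< a b (subst T (sym e) tt)

<ᵇ-false⁻ : ∀ {a b} → (a <ᵇ b) ≡ false → ¬ a < b
<ᵇ-false⁻ e a<b = case trans (sym (<ᵇ-true a<b)) e of λ ()

suc<ᵇ : ∀ a j → (suc a <ᵇ j) ≡ (a <ᵇ (j ∸ 1))
suc<ᵇ a zero    = refl
suc<ᵇ a (suc j) = refl

DropsAt : (ℕ → ℕ) → ℕ → ℕ → Set
DropsAt f B J = ∀ j → j ≤ B → (j < J → f j ≡ j) × (J ≤ j → suc (f j) ≡ j)

module _ {f : ℕ → ℕ} {B : ℕ}
  (bounded : ∀ j → j ≤ B → f j ≤ j × j ≤ suc (f j))
  (step : ∀ j → f (suc j) ≤ suc (f j)) where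

  private
    stays-below : ∀ j d → f j < j → f (d + j) < d + j
    stays-below j zero    fj<j = fj<j
    stays-below j (suc d) fj<j = s≤s (≤-trans (step (d + j)) (stays-below j d fj<j))

    dropped : ∀ j → j ≤ B → f j < j → suc (f j) ≡ j
    dropped j j≤B fj<j = ≤-antisym fj<j (proj₂ (bounded j j≤B))

  drops-somewhere : ∀ B′ → B′ ≤ B → f B′ < B′ → ∃[ J ] (1 ≤ J × J ≤ B′ × DropsAt f B′ J)
  drops-somewhere (suc B′) 1+B′≤B fB<B with f B′ <? B′
  ... | yes fB′<B′ with drops-somewhere B′ (≤-trans (n≤1+n B′) 1+B′≤B) fB′<B′
  ...   | J , 1≤J , J≤B′ , drops = J , 1≤J , m≤n⇒m≤1+n J≤B′ , drops′
    where
    drops′ : DropsAt f (suc B′) J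
    drops′ j j≤ with j ≤? B′
    ... | yes j≤B′ = drops j j≤B′
    ... | no j≰B′ with ≤-antisym j≤ (≰⇒> j≰B′)
    ...   | refl = (λ j<J → ⊥-elim (≤⇒≯ (m≤n⇒m≤1+n J≤B′) j<J)) , λ _ → dropped j 1+B′≤B fB<B
  drops-somewhere (suc B′) 1+B′≤B fB<B | no fB′≮B′ = suc B′ , s≤s z≤n , ≤-refl , drops′
    where
    full : ∀ j → j ≤ B′ → f j ≡ j
    full j j≤B′ with f j <? j
    ... | no fj≮j = ≤-antisym (proj₁ (bounded j (≤-trans j≤B′ (≤-trans (n≤1+n B′) 1+B′≤B)))) (≮⇒≥ fj≮j)
    ... | yes fj<j = ⊥-elim (fB′≮B′ (subst (λ z → f z < z) (m∸n+n≡m j≤B′) (stays-below j (B′ ∸ j) fj<j)))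
    drops′ : DropsAt f (suc B′) (suc B′)
    drops′ j j≤ = (λ j<J → full j (≤-pred j<J)) , λ J≤j → last (≤-antisym j≤ J≤j)
      where
      last : j ≡ suc B′ → suc (f j) ≡ j
      last refl = dropped j 1+B′≤B fB<B

sum< : ℕ → (ℕ → ℕ) → ℕ
sum< zero    f = 0
sum< (suc B) f = sum< B f + f B

sum<-cong : ∀ B {f g} → (∀ j → j < B → f j ≡ g j) → sum< B f ≡ sum< B g
sum<-cong zero    f≡g = refl
sum<-cong (suc B) f≡g = cong₂ _+_ (sum<-cong B (λ j j<B → f≡g j (<-trans j<B (n<1+n B)))) (f≡g B (n<1+n B))

sum<-transfer : ∀ {f g} u → g u ≡ suc (f u) → suc (g (suc u)) ≡ f (suc u) →
  (∀ j → j ≢ u → j ≢ suc u → g j ≡ f j) → ∀ B → suc (suc u) ≤ B → sum< B g ≡ sum< B f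
sum<-transfer {f} {g} u gu g1+u elsewhere B 2+u≤B =
  subst (λ B → sum< B g ≡ sum< B f) (m∸n+n≡m 2+u≤B) (go (B ∸ suc (suc u)))
  where
  go : ∀ d → sum< (d + suc (suc u)) g ≡ sum< (d + suc (suc u)) f
  go zero = begin
    sum< u g + g u + g (suc u)           ≡⟨ cong₂ (λ x y → x + y + g (suc u)) (sum<-cong u below) gu ⟩
    sum< u f + suc (f u) + g (suc u)     ≡⟨ shift-suc (sum< u f) (f u) (g (suc u)) ⟩
    sum< u f + f u + suc (g (suc u))     ≡⟨ cong (λ x → sum< u f + f u + x) g1+u ⟩
    sum< u f + f u + f (suc u)           ∎
    where
    open ≡-Reasoning
    shift-suc : ∀ a b c → a + suc b + c ≡ a + b + suc c
    shift-suc = solve-∀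
    below : ∀ j → j < u → g j ≡ f j
    below j j<u = elsewhere j (<⇒≢ j<u) (<⇒≢ (<-trans j<u (n<1+n u)))
  go (suc d) = cong₂ _+_ (go d) (elsewhere (d + suc (suc u)) (≢u (≤-trans (n≤1+n _) beyond)) (≢u beyond))
    where
    beyond : suc (suc u) ≤ d + suc (suc u)
    beyond = m≤n+m (suc (suc u)) d
    ≢u : ∀ {x y} → suc x ≤ y → y ≢ x
    ≢u x<y refl = 1+n≰n x<y

∸-indicator : ∀ B c → B ∸ c ≡ (B ∸ suc c) + bit (c <ᵇ B)
∸-indicator zero    zero    = refl
∸-indicator zero    (suc c) = refl
∸-indicator (suc B) zero    = +-comm 1 B
∸-indicator (suc B) (suc c) = ∸-indicator B c

sum<-indicator : ∀ B c f → sum< B (λ j → bit (c <ᵇ j) + f j) ≡ (B ∸ suc c) + sum< B f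
sum<-indicator zero    c f = refl
sum<-indicator (suc B) c f rewrite sum<-indicator B c f | ∸-indicator B c =
  regroup (B ∸ suc c) (sum< B f) (bit (c <ᵇ B)) (f B)
  where
  regroup : ∀ a s x y → a + s + (x + y) ≡ a + x + (s + y)
  regroup = solve-∀

half-suc-suc : ∀ k → suc (suc k) / 2 ≡ suc (k / 2)
half-suc-suc k = m/n≡1+[m∸n]/n {suc (suc k)} {2} (s≤s (s≤s z≤n))

half+half : ∀ k → k / 2 + suc k / 2 ≡ k
half+half zero          = refl
half+half (suc zero)    = refl
half+half (suc (suc k)) rewrite half-suc-suc k | half-suc-suc (suc k) =
  cong suc (trans (+-suc (k / 2) _) (cong suc (half+half k)))

half-suc-bounds : ∀ k → k / 2 ≤ suc k / 2 × suc k / 2 ≤ suc (k / 2)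
half-suc-bounds zero          = z≤n , z≤n
half-suc-bounds (suc zero)    = z≤n , ≤-refl
half-suc-bounds (suc (suc k)) rewrite half-suc-suc k | half-suc-suc (suc k) =
  let lower , upper = half-suc-bounds k in s≤s lower , s≤s upper

half-pred-bounds : ∀ n → 1 ≤ n → (n ∸ 1) / 2 ≤ n / 2 × n / 2 ≤ suc ((n ∸ 1) / 2)
half-pred-bounds (suc n) _ = half-suc-bounds n

∸+∸≡⇒+≡ : ∀ {P x y} → x ≤ P → y ≤ P → (P ∸ x) + (P ∸ y) ≡ P → x + y ≡ P
∸+∸≡⇒+≡ {P} {x} {y} x≤P y≤P e = +-cancelˡ-≡ P _ _ (begin
  P + (x + y)                   ≡⟨ cong (_+ (x + y)) e ⟨
  (P ∸ x) + (P ∸ y) + (x + y)   ≡⟨ regroup (P ∸ x) (P ∸ y) x y ⟩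
  ((P ∸ x) + x) + ((P ∸ y) + y) ≡⟨ cong₂ _+_ (m∸n+n≡m x≤P) (m∸n+n≡m y≤P) ⟩
  P + P                         ∎)
  where
  open ≡-Reasoning
  regroup : ∀ u v x y → u + v + (x + y) ≡ (u + x) + (v + y)
  regroup = solve-∀

complement-of-half : ∀ n → 1 ≤ n → ∀ h → h + suc ((n ∸ 1) / 2) ≡ suc n → h ≡ suc (n / 2)
complement-of-half (suc n) _ h e =
  +-cancelʳ-≡ (suc (n / 2)) _ _ (trans e (cong suc (trans (cong suc (sym (half+half n))) (swap (n / 2) (suc n / 2)))))
  where
  swap : ∀ x y → suc (x + y) ≡ y + suc x
  swap = solve-∀

-- Moves and runs

split-last : ∀ {A : Set} (xs : List A) → xs ≢ [] → ∃[ ys ] ∃[ y ] xs ≡ ys ++ [ y ]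
split-last xs xs≢[] with initLast xs
... | []       = ⊥-elim (xs≢[] refl)
... | ys ∷ʳ′ y = ys , y , refl

apply-left : ∀ {m} (c : Config m) p q → apply c (p , q) p ≡ (label (c p) , pos (c p) ℤ.- + 1)
apply-left c p q with p ≟ p
... | yes _  = refl
... | no p≢p = ⊥-elim (p≢p refl)

apply-right : ∀ {m} (c : Config m) p q → q ≢ p → apply c (p , q) q ≡ (label (c q) , pos (c q) ℤ.+ + 1)
apply-right c p q q≢p with q ≟ p | q ≟ q
... | yes q≡p | _     = ⊥-elim (q≢p q≡p)
... | no _    | yes _ = refl
... | no _    | no q≢q = ⊥-elim (q≢q refl)

label-apply : ∀ {m} (c : Config m) mv x → label (apply c mv x) ≡ label (c x)
label-apply c (p , q) x with x ≟ p | x ≟ q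
... | yes _ | _     = refl
... | no _  | yes _ = refl
... | no _  | no _  = refl

label-exec : ∀ {m} (c : Config m) ms x → label (exec c ms x) ≡ label (c x)
label-exec c []        x = refl
label-exec c (mv ∷ ms) x = trans (label-exec (apply c mv) ms x) (label-apply c mv x)

valid⇒≢ : ∀ {m} {c : Config m} {p q} → Valid c (p , q) → q ≢ p
valid⇒≢ (lt , _) refl = <-irrefl refl lt

shift : ∀ {m} → Move m → Fin m → Chip → Chip
shift (p , q) x ch with x ≟ p | x ≟ q
... | yes _ | _     = label ch , pos ch ℤ.- + 1
... | no _  | yes _ = label ch , pos ch ℤ.+ + 1
... | no _  | no _  = ch

apply-shift : ∀ {m} (c : Config m) mv x → apply c mv x ≡ shift mv x (c x)
apply-shift c (p , q) x with x ≟ p | x ≟ q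
... | yes _ | _     = refl
... | no _  | yes _ = refl
... | no _  | no _  = refl

shift-avoiding : ∀ {m} {x : Fin m} {mv} ch → Avoids x mv → shift mv x ch ≡ ch
shift-avoiding {x = x} {p , q} ch (p≢x , q≢x) with x ≟ p | x ≟ q
... | yes x≡p | _       = ⊥-elim (p≢x (sym x≡p))
... | no _    | yes x≡q = ⊥-elim (q≢x (sym x≡q))
... | no _    | no _    = refl

apply-avoiding : ∀ {m} (c : Config m) {x mv} → Avoids x mv → apply c mv x ≡ c x
apply-avoiding c {x} {mv} av = trans (apply-shift c mv x) (shift-avoiding (c x) av)

avoids? : ∀ {m} (x : Fin m) mv → Dec (Avoids x mv)
avoids? x (p , q) with p ≟ x | q ≟ x
... | yes p≡x | _       = no (λ av → proj₁ av p≡x)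
... | no _    | yes q≡x = no (λ av → proj₂ av q≡x)
... | no p≢x  | no q≢x  = yes (p≢x , q≢x)

Disjoint : ∀ {m} → Move m → Move m → Set
Disjoint (p , q) mv = Avoids p mv × Avoids q mv

disjoint-sym : ∀ {m} {m₁ m₂ : Move m} → Disjoint m₁ m₂ → Disjoint m₂ m₁
disjoint-sym {m₁ = _ , _} {_ , _} ((a , b) , (c , d)) = (a ∘ sym , c ∘ sym) , (b ∘ sym , d ∘ sym)

disjoint-avoids : ∀ {m} {x : Fin m} {m₁ m₂} → Disjoint m₁ m₂ → ¬ Avoids x m₁ → Avoids x m₂
disjoint-avoids {x = x} {p , q} (p∉m₂ , q∉m₂) x∈m₁ with x ≟ p | x ≟ q
... | yes refl | _        = p∉m₂
... | no _     | yes refl = q∉m₂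
... | no x≢p   | no x≢q   = ⊥-elim (x∈m₁ (x≢p ∘ sym , x≢q ∘ sym))

shift-comm : ∀ {m} {m₁ m₂ : Move m} → Disjoint m₁ m₂ → ∀ x ch →
  shift m₂ x (shift m₁ x ch) ≡ shift m₁ x (shift m₂ x ch)
shift-comm {m₁ = m₁} {m₂} d x ch with avoids? x m₁
... | yes x∉m₁ = trans (cong (shift m₂ x) (shift-avoiding ch x∉m₁)) (sym (shift-avoiding _ x∉m₁))
... | no x∈m₁  = trans (shift-avoiding _ x∉m₂) (cong (shift m₁ x) (sym (shift-avoiding ch x∉m₂)))
  where x∉m₂ = disjoint-avoids d x∈m₁

apply-comm : ∀ {m} (c : Config m) {m₁ m₂} → Disjoint m₁ m₂ → apply (apply c m₁) m₂ ≗ apply (apply c m₂) m₁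
apply-comm c {m₁} {m₂} d x = begin
  apply (apply c m₁) m₂ x          ≡⟨ apply-shift _ m₂ x ⟩
  shift m₂ x (apply c m₁ x)        ≡⟨ cong (shift m₂ x) (apply-shift c m₁ x) ⟩
  shift m₂ x (shift m₁ x (c x))    ≡⟨ shift-comm d x (c x) ⟩
  shift m₁ x (shift m₂ x (c x))    ≡⟨ cong (shift m₁ x) (apply-shift c m₂ x) ⟨
  shift m₁ x (apply c m₂ x)        ≡⟨ apply-shift _ m₁ x ⟨
  apply (apply c m₂) m₁ x          ∎
  where open ≡-Reasoning

apply-≗ : ∀ {m} {c d : Config m} mv → c ≗ d → apply c mv ≗ apply d mv
apply-≗ {c = c} {d} mv c≗d x =
  trans (apply-shift c mv x) (trans (cong (shift mv x) (c≗d x)) (sym (apply-shift d mv x)))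

exec-≗ : ∀ {m} {c d : Config m} ms → c ≗ d → exec c ms ≗ exec d ms
exec-≗ []        c≗d = c≗d
exec-≗ (mv ∷ ms) c≗d = exec-≗ ms (apply-≗ mv c≗d)

valid-≗ : ∀ {m} {c d : Config m} mv → c ≗ d → Valid c mv → Valid d mv
valid-≗ (p , q) c≗d (lt , same) =
  subst₂ _<_ (cong label (c≗d p)) (cong label (c≗d q)) lt ,
  trans (sym (cong pos (c≗d p))) (trans same (cong pos (c≗d q)))

run-≗ : ∀ {m} {c d : Config m} {ms} → c ≗ d → Run c ms → Run d ms
run-≗ c≗d done                  = done
run-≗ c≗d (step {mv = mv} v r) = step (valid-≗ mv c≗d v) (run-≗ (apply-≗ mv c≗d) r)

stable-≗ : ∀ {m} {c d : Config m} → c ≗ d → Stable c → Stable d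
stable-≗ c≗d st i j i≢j same = st i j i≢j (trans (cong pos (c≗d i)) (trans same (sym (cong pos (c≗d j)))))

readsIdentity-≗ : ∀ {m} {c d : Config m} → c ≗ d → ReadsIdentity c → ReadsIdentity d
readsIdentity-≗ c≗d rid i j lt =
  subst₂ ℤ._<_ (cong pos (c≗d i)) (cong pos (c≗d j))
    (rid i j (subst₂ _<_ (sym (cong label (c≗d i))) (sym (cong label (c≗d j))) lt))

valid-after : ∀ {m} {c : Config m} {m₁ m₂} → Disjoint m₂ m₁ → Valid c m₂ → Valid (apply c m₁) m₂
valid-after {c = c} {m₂ = p , q} (p∉m₁ , q∉m₁) (lt , same) =
  subst₂ _<_ (sym (cong label (apply-avoiding c p∉m₁))) (sym (cong label (apply-avoiding c q∉m₁))) lt ,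
  trans (cong pos (apply-avoiding c p∉m₁)) (trans same (sym (cong pos (apply-avoiding c q∉m₁))))

valid-before : ∀ {m} {c : Config m} {m₁ m₂} → Disjoint m₂ m₁ → Valid (apply c m₁) m₂ → Valid c m₂
valid-before {c = c} {m₂ = p , q} (p∉m₁ , q∉m₁) (lt , same) =
  subst₂ _<_ (cong label (apply-avoiding c p∉m₁)) (cong label (apply-avoiding c q∉m₁)) lt ,
  trans (sym (cong pos (apply-avoiding c p∉m₁))) (trans same (cong pos (apply-avoiding c q∉m₁)))

stable⇒¬valid : ∀ {m} {c : Config m} → Stable c → ∀ mv → ¬ Valid c mv
stable⇒¬valid st (p , q) v = st p q (valid⇒≢ v ∘ sym) (proj₂ v)

exec-++ : ∀ {m} (c : Config m) xs ys → exec c (xs ++ ys) ≡ exec (exec c xs) ys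
exec-++ c []       ys = refl
exec-++ c (x ∷ xs) ys = exec-++ (apply c x) xs ys

run-++⁻ : ∀ {m} {c : Config m} xs {ys} → Run c (xs ++ ys) → Run c xs × Run (exec c xs) ys
run-++⁻ []       r          = done , r
run-++⁻ (x ∷ xs) (step v r) = let r₁ , r₂ = run-++⁻ xs r in step v r₁ , r₂

move-to-front : ∀ {m} {c : Config m} as {mv bs} → All (Disjoint mv) as → Run c (as ++ mv ∷ bs) →
  Run c (mv ∷ as ++ bs) × exec c (mv ∷ as ++ bs) ≗ exec c (as ++ mv ∷ bs)
move-to-front []       []       r          = r , λ _ → refl
move-to-front {c = c} (a ∷ as) {mv} {bs} (d ∷ ds) (step va r) with move-to-front as ds r
... | step vm r′ , same =
  step vm₀ (step (valid-after (disjoint-sym d) va) (run-≗ (λ x → sym (comm x)) r′)) ,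
  λ x → trans (exec-≗ (as ++ bs) comm x) (same x)
  where
  vm₀ : Valid c mv
  vm₀ = valid-before d vm
  comm : apply (apply c mv) a ≗ apply (apply c a) mv
  comm = apply-comm c d

lastMoveLeft-∷ : ∀ {m} {i : Fin m} {ms} mv → LastMoveLeft i ms → LastMoveLeft i (mv ∷ ms)
lastMoveLeft-∷ mv (xs , q , ys , refl , avs) = mv ∷ xs , q , ys , refl , avs

lastMoveRight-∷ : ∀ {m} {i : Fin m} {ms} mv → LastMoveRight i ms → LastMoveRight i (mv ∷ ms)
lastMoveRight-∷ mv (xs , p , ys , refl , avs) = mv ∷ xs , p , ys , refl , avs

-- Balanced configurations

module Sites (m : ℕ) (lo : ℤ) where

  site : ℕ → ℤ
  site t = lo ℤ.+ + t

  site-mono-< : ∀ {a b} → a < b → site a ℤ.< site b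
  site-mono-< a<b = ℤP.+-monoʳ-< lo (ℤ.+<+ a<b)

  site-cancel-< : ∀ {a b} → site a ℤ.< site b → a < b
  site-cancel-< {a} {b} lt with a <? b
  ... | yes a<b = a<b
  ... | no a≮b  = ⊥-elim (ℤP.<⇒≱ lt (ℤP.+-monoʳ-≤ lo (ℤ.+≤+ (≮⇒≥ a≮b))))

  site-injective : ∀ {a b} → site a ≡ site b → a ≡ b
  site-injective {a} {b} e with <-cmp a b
  ... | tri< a<b _ _ = ⊥-elim (ℤP.<-irrefl e (site-mono-< a<b))
  ... | tri≈ _ a≡b _ = a≡b
  ... | tri> _ _ b<a = ⊥-elim (ℤP.<-irrefl (sym e) (site-mono-< b<a))

  site-<ᵇ : ∀ a b → does (site a ℤP.<? site b) ≡ (a <ᵇ b)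
  site-<ᵇ a b with a <? b
  ... | yes a<b = trans (dec-true (site a ℤP.<? site b) (site-mono-< a<b)) (sym (<ᵇ-true a<b))
  ... | no a≮b  = trans (dec-false (site a ℤP.<? site b) (a≮b ∘ site-cancel-<)) (sym (<ᵇ-false a≮b))

  site-pred : ∀ k → site (suc k) ℤ.- + 1 ≡ site k
  site-pred k = ℤP.+-assoc lo (+ suc k) (- (+ 1))

  site-suc : ∀ k → site k ℤ.+ + 1 ≡ site (suc k)
  site-suc k = trans (ℤP.+-assoc lo (+ k) (+ 1)) (cong (λ z → lo ℤ.+ + z) (+-comm k 1))

  At : Config m → Fin m → ℕ → Set
  At c i t = pos (c i) ≡ site t

  at-unique : ∀ c i {t t′} → At c i t → At c i t′ → t ≡ t′
  at-unique c i at at′ = site-injective (trans (sym at) at′)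

  leftOf : Config m → ℕ → Fin m → Bool
  leftOf c j i = does (pos (c i) ℤP.<? site j)

  #left : Config m → ℕ → ℕ
  #left c j = count (leftOf c j)

  leftOf-at : ∀ c i {t} j → At c i t → leftOf c j i ≡ (t <ᵇ j)
  leftOf-at c i {t} j at = trans (cong (λ z → does (z ℤP.<? site j)) at) (site-<ᵇ t j)

  leftOf-mono : ∀ c j → leftOf c j ⊆ᵇ leftOf c (suc j)
  leftOf-mono c j i e with pos (c i) ℤP.<? site j | pos (c i) ℤP.<? site (suc j)
  ... | yes _  | yes _  = refl
  ... | yes lt | no ≮   = ⊥-elim (≮ (ℤP.<-trans lt (site-mono-< (n<1+n j))))

  #left-≤ : ∀ c j → #left c j ≤ m
  #left-≤ c j = count-≤ (leftOf c j)

  -- Every chip sits on one of the sites 0 … m, and the sites left of any j hold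
  -- j or j − 1 chips.  Toppling preserves this, and it pins down the shape of
  -- every toppling (Topple).
  record Balanced (c : Config m) : Set where
    field
      on-site    : ∀ i → ∃[ t ] (At c i t × t ≤ m)
      #left≤     : ∀ j → j ≤ suc m → #left c j ≤ j
      ≤suc-#left : ∀ j → j ≤ suc m → j ≤ suc (#left c j)

  open Balanced

  two-on-site : ∀ c p q k → p ≢ q → At c p k → At c q k → 2 + #left c k ≤ #left c (suc k)
  two-on-site c p q k p≢q p-at q-at =
    count-gain₂ p q p≢q (leftOf-mono c k)
      (trans (leftOf-at c p k p-at) (<ᵇ-false (n≮n k))) (trans (leftOf-at c p (suc k) p-at) (<ᵇ-true (n<1+n k)))
      (trans (leftOf-at c q k q-at) (<ᵇ-false (n≮n k))) (trans (leftOf-at c q (suc k) q-at) (<ᵇ-true (n<1+n k)))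

  no-three-on-site : ∀ {c} → Balanced c → ∀ p q r k → p ≢ q → p ≢ r → q ≢ r →
    At c p k → At c q k → At c r k → ⊥
  no-three-on-site {c} B p q r k p≢q p≢r q≢r p-at q-at r-at = 1+n≰n (begin
    3 + #left c k          ≤⟨ gain ⟩
    #left c (suc k)        ≤⟨ #left≤ B (suc k) (s≤s k≤m) ⟩
    suc k                  ≤⟨ s≤s (≤suc-#left B k (≤-trans k≤m (n≤1+n m))) ⟩
    suc (suc (#left c k))  ∎)
    where
    open ≤-Reasoning
    k≤m : k ≤ m
    k≤m with on-site B p
    ... | t , at , t≤m = subst (_≤ m) (at-unique c p at p-at) t≤m
    false-at : ∀ {i} → At c i k → leftOf c k i ≡ false
    false-at {i} at = trans (leftOf-at c i k at) (<ᵇ-false (n≮n k))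
    true-at : ∀ {i} → At c i k → leftOf c (suc k) i ≡ true
    true-at {i} at = trans (leftOf-at c i (suc k) at) (<ᵇ-true (n<1+n k))
    gain : 3 + #left c k ≤ #left c (suc k)
    gain = count-gain₃ p q r p≢q p≢r q≢r (leftOf-mono c k)
      (false-at p-at) (true-at p-at) (false-at q-at) (true-at q-at) (false-at r-at) (true-at r-at)

  record Topple (c : Config m) (p q : Fin m) : Set where
    field
      k            : ℕ
      p-at         : At c p (suc k)
      q-at         : At c q (suc k)
      #left-at     : #left c (suc k) ≡ k
      #left-beyond : #left c (suc (suc k)) ≡ suc (suc k)
      in-range     : suc (suc k) ≤ m

  topple : ∀ {c p q} → Balanced c → Valid c (p , q) → Topple c p q
  topple {c} {p} {q} B (lt , same-pos) = record
    { k            = #left c t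
    ; p-at         = subst (At c p) t≡ p-at
    ; q-at         = subst (At c q) t≡ q-at
    ; #left-at     = cong (#left c) (sym t≡)
    ; #left-beyond = trans (cong (#left c ∘ suc) (sym t≡)) (trans #left-suc-t (cong suc t≡))
    ; in-range     = subst (_≤ m) (trans #left-suc-t (cong suc t≡)) (#left-≤ c (suc t))
    }
    where
    t = proj₁ (on-site B p)
    p-at = proj₁ (proj₂ (on-site B p))
    t≤m = proj₂ (proj₂ (on-site B p))
    q-at : At c q t
    q-at = trans (sym same-pos) p-at
    two : 2 + #left c t ≤ #left c (suc t)
    two = two-on-site c p q t (λ p≡q → <-irrefl (cong (label ∘ c) p≡q) lt) p-at q-at
    t≡ : t ≡ suc (#left c t)
    t≡ = ≤-antisym (≤suc-#left B t (≤-trans t≤m (n≤1+n m)))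
                   (≤-pred (≤-trans two (#left≤ B (suc t) (s≤s t≤m))))
    #left-suc-t : #left c (suc t) ≡ suc t
    #left-suc-t = ≤-antisym (#left≤ B (suc t) (s≤s t≤m))
                            (subst (λ z → suc z ≤ #left c (suc t)) (sym t≡) two)

  module Toppled {c : Config m} {p q : Fin m} (B : Balanced c) (v : Valid c (p , q)) where
    open Topple (topple B v) public

    q≢p : q ≢ p
    q≢p = valid⇒≢ {c = c} v

    c′ : Config m
    c′ = apply c (p , q)

    p-at′ : At c′ p k
    p-at′ = trans (cong pos (apply-left c p q)) (trans (cong (ℤ._- + 1) p-at) (site-pred k))

    q-at′ : At c′ q (suc (suc k))
    q-at′ = trans (cong pos (apply-right c p q q≢p)) (trans (cong (ℤ._+ + 1) q-at) (site-suc (suc k)))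

    unmoved : ∀ x → x ≢ p → x ≢ q → c′ x ≡ c x
    unmoved x x≢p x≢q = apply-avoiding c (x≢p ∘ sym , x≢q ∘ sym)

    #left-transfer : ∀ j → #left c j + bit (k <ᵇ j) + bit (suc (suc k) <ᵇ j)
                         ≡ #left c′ j + bit (suc k <ᵇ j) + bit (suc k <ᵇ j)
    #left-transfer j = begin
      #left c j + bit (k <ᵇ j) + bit (suc (suc k) <ᵇ j)
        ≡⟨ cong₂ (λ a b → #left c j + bit a + bit b) (leftOf-at c′ p j p-at′) (leftOf-at c′ q j q-at′) ⟨
      #left c j + bit (leftOf c′ j p) + bit (leftOf c′ j q)
        ≡⟨ count-update₂ (leftOf c j) (leftOf c′ j) p q (q≢p ∘ sym)
             (λ i i≢p i≢q → cong (λ z → does (pos z ℤP.<? site j)) (sym (unmoved i i≢p i≢q))) ⟩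
      #left c′ j + bit (leftOf c j p) + bit (leftOf c j q)
        ≡⟨ cong₂ (λ a b → #left c′ j + bit a + bit b) (leftOf-at c p j p-at) (leftOf-at c q j q-at) ⟩
      #left c′ j + bit (suc k <ᵇ j) + bit (suc k <ᵇ j) ∎
      where open ≡-Reasoning

    private
      cancel₀ : ∀ {a b c d x y} → x + bit a + bit b ≡ y + bit c + bit d →
        a ≡ false → b ≡ false → c ≡ false → d ≡ false → y ≡ x
      cancel₀ e refl refl refl refl = sym (+-cancelʳ-≡ 0 _ _ (+-cancelʳ-≡ 0 _ _ e))
      cancel₁ : ∀ {a b c d x y} → x + bit a + bit b ≡ y + bit c + bit d →
        a ≡ true → b ≡ true → c ≡ true → d ≡ true → y ≡ x
      cancel₁ e refl refl refl refl = sym (+-cancelʳ-≡ 1 _ _ (+-cancelʳ-≡ 1 _ _ e))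

    #left-unchanged : ∀ j → j ≢ suc k → j ≢ suc (suc k) → #left c′ j ≡ #left c j
    #left-unchanged j j≢1+k j≢2+k with <-cmp j (suc k)
    ... | tri≈ _ j≡1+k _ = ⊥-elim (j≢1+k j≡1+k)
    ... | tri< j<1+k _ _ =
      cancel₀ (#left-transfer j) (<ᵇ-false (≤⇒≯ j≤k)) (<ᵇ-false (≤⇒≯ (≤-trans j≤k (≤-trans (n≤1+n k) (n≤1+n (suc k))))))
                                 (<ᵇ-false (≤⇒≯ (≤-trans j≤k (n≤1+n k)))) (<ᵇ-false (≤⇒≯ (≤-trans j≤k (n≤1+n k))))
      where
      j≤k : j ≤ k
      j≤k = ≤-pred j<1+k
    ... | tri> _ _ 1+k<j with <-cmp j (suc (suc k))
    ...   | tri≈ _ j≡2+k _ = ⊥-elim (j≢2+k j≡2+k)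
    ...   | tri< j<2+k _ _ = ⊥-elim (≤⇒≯ (≤-pred j<2+k) 1+k<j)
    ...   | tri> _ _ 2+k<j =
      cancel₁ (#left-transfer j) (<ᵇ-true (<-trans (n<1+n k) 1+k<j)) (<ᵇ-true 2+k<j) (<ᵇ-true 1+k<j) (<ᵇ-true 1+k<j)

    #left-at′ : #left c′ (suc k) ≡ suc k
    #left-at′ = trans (cancel (#left-transfer (suc k)) (<ᵇ-true (n<1+n k)) (<ᵇ-false (≤⇒≯ (n≤1+n (suc k))))
                                 (<ᵇ-false (n≮n (suc k))) (<ᵇ-false (n≮n (suc k))))
                      (cong suc #left-at)
      where
      cancel : ∀ {a b c d x y} → x + bit a + bit b ≡ y + bit c + bit d →
        a ≡ true → b ≡ false → c ≡ false → d ≡ false → y ≡ suc x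
      cancel {x = x} e refl refl refl refl =
        sym (trans (+-comm 1 x) (trans (sym (+-identityʳ (x + 1))) (trans e (trans (+-identityʳ _) (+-identityʳ _)))))

    #left-beyond′ : #left c′ (suc (suc k)) ≡ suc k
    #left-beyond′ = suc-injective (trans (cancel (#left-transfer (suc (suc k)))
                      (<ᵇ-true (<-trans (n<1+n k) (n<1+n (suc k)))) (<ᵇ-false (n≮n (suc (suc k))))
                      (<ᵇ-true (n<1+n (suc k))) (<ᵇ-true (n<1+n (suc k)))) #left-beyond)
      where
      cancel : ∀ {a b c d x y} → x + bit a + bit b ≡ y + bit c + bit d →
        a ≡ true → b ≡ false → c ≡ true → d ≡ true → suc y ≡ x
      cancel {x = x} {y} e refl refl refl refl =
        sym (+-cancelʳ-≡ 1 x (suc y) (trans (sym (+-identityʳ (x + 1))) (trans e (cong (_+ 1) (+-comm y 1)))))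

    balanced′ : Balanced c′
    balanced′ = record { on-site = on-site′ ; #left≤ = #left≤′ ; ≤suc-#left = ≤suc-#left′ }
      where
      on-site′ : ∀ i → ∃[ t ] (At c′ i t × t ≤ m)
      on-site′ i = by-cases (i ≟ p) (i ≟ q)
        where
        by-cases : Dec (i ≡ p) → Dec (i ≡ q) → ∃[ t ] (At c′ i t × t ≤ m)
        by-cases (yes refl) _ = k , p-at′ , ≤-trans (n≤1+n k) (≤-trans (n≤1+n (suc k)) in-range)
        by-cases (no _) (yes refl) = suc (suc k) , q-at′ , in-range
        by-cases (no i≢p) (no i≢q) with on-site B i
        ... | t , at , t≤m = t , trans (cong pos (unmoved i i≢p i≢q)) at , t≤m
      #left≤′ : ∀ j → j ≤ suc m → #left c′ j ≤ j
      #left≤′ j j≤ with j ≟ℕ suc k | j ≟ℕ suc (suc k)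
      ... | yes refl | _        = ≤-reflexive #left-at′
      ... | no _     | yes refl = subst (_≤ suc (suc k)) (sym #left-beyond′) (n≤1+n _)
      ... | no j≢1+k | no j≢2+k = subst (_≤ j) (sym (#left-unchanged j j≢1+k j≢2+k)) (#left≤ B j j≤)
      ≤suc-#left′ : ∀ j → j ≤ suc m → j ≤ suc (#left c′ j)
      ≤suc-#left′ j j≤ with j ≟ℕ suc k | j ≟ℕ suc (suc k)
      ... | yes refl | _        = subst (λ z → suc k ≤ suc z) (sym #left-at′) (n≤1+n _)
      ... | no _     | yes refl = subst (λ z → suc (suc k) ≤ suc z) (sym #left-beyond′) ≤-refl
      ... | no j≢1+k | no j≢2+k = subst (λ z → j ≤ suc z) (sym (#left-unchanged j j≢1+k j≢2+k)) (≤suc-#left B j j≤)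

  balanced-apply : ∀ {c p q} → Balanced c → Valid c (p , q) → Balanced (apply c (p , q))
  balanced-apply B v = Toppled.balanced′ B v

  balanced-exec : ∀ {c ms} → Balanced c → Run c ms → Balanced (exec c ms)
  balanced-exec B done = B
  balanced-exec B (step {mv = _ , _} v r) = balanced-exec (balanced-apply B v) r

  valid-disjoint : ∀ {c} → Balanced c → ∀ {m₁ m₂} → Valid c m₁ → Valid c m₂ → m₁ ≢ m₂ → Disjoint m₁ m₂
  valid-disjoint {c} B {p , q} {p′ , q′} v₁@(l₁ , e₁) v₂@(l₂ , e₂) m₁≢m₂ =
    (p≢p′ ∘ sym , p≢q′ ∘ sym) , (q≢p′ ∘ sym , q≢q′ ∘ sym)
    where
    t = proj₁ (on-site B p)
    p-at : At c p t
    p-at = proj₁ (proj₂ (on-site B p))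
    q-at : At c q t
    q-at = trans (sym e₁) p-at
    p≢q : p ≢ q
    p≢q = valid⇒≢ v₁ ∘ sym
    p′≢q′ : p′ ≢ q′
    p′≢q′ = valid⇒≢ v₂ ∘ sym
    three = no-three-on-site B
    p≢p′ : p ≢ p′
    p≢p′ refl with q ≟ q′
    ... | yes refl  = m₁≢m₂ refl
    ... | no q≢q′ = three p q q′ t p≢q p′≢q′ q≢q′ p-at q-at (trans (sym e₂) p-at)
    p≢q′ : p ≢ q′
    p≢q′ refl with p′ ≟ q
    ... | yes refl  = <-asym l₁ l₂
    ... | no p′≢q = three p q p′ t p≢q (p′≢q′ ∘ sym) (p′≢q ∘ sym) p-at q-at (trans e₂ p-at)
    q≢p′ : q ≢ p′
    q≢p′ refl with p ≟ q′
    ... | yes refl  = <-asym l₁ l₂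
    ... | no p≢q′ = three p q q′ t p≢q p≢q′ p′≢q′ p-at q-at (trans (sym e₂) q-at)
    q≢q′ : q ≢ q′
    q≢q′ refl with p ≟ p′
    ... | yes refl  = m₁≢m₂ refl
    ... | no p≢p′ = three p q p′ t p≢q p≢p′ (p′≢q′ ∘ sym) p-at q-at (trans e₂ q-at)

  -- A move valid in a balanced configuration stays valid until it is performed,
  -- so it occurs in every run that reaches a stable configuration.
  valid-move-occurs : ∀ {c mv ys} → Balanced c → Valid c mv → Run c ys → Stable (exec c ys) →
    ∃[ as ] ∃[ bs ] (ys ≡ as ++ mv ∷ bs × All (Disjoint mv) as)
  valid-move-occurs {c} {mv} B v done st = ⊥-elim (stable⇒¬valid {c = c} st mv v)
  valid-move-occurs {c} {mv} B v (step {mv = y} {ms = ys} vy r) st with ≡-dec _≟_ _≟_ y mv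
  ... | yes refl = [] , ys , refl , []
  ... | no y≢mv with valid-disjoint B v vy (y≢mv ∘ sym)
  ...   | d with valid-move-occurs {mv = mv} (balanced-apply {c} B vy) (valid-after {c = c} d v) r st
  ...     | as , bs , refl , ds = y ∷ as , bs , refl , d ∷ ds

  confluent : ∀ {c ms ms′} → Balanced c → Run c ms → Stable (exec c ms) →
    Run c ms′ → Stable (exec c ms′) → exec c ms ≗ exec c ms′
  confluent {ms = ms} = go (length ms) refl
    where
    go : ∀ n {c ms ms′} → length ms ≡ n → Balanced c → Run c ms → Stable (exec c ms) →
      Run c ms′ → Stable (exec c ms′) → exec c ms ≗ exec c ms′
    go _ _ B done st done st′ = λ _ → refl
    go _ {c} _ B done st (step {mv = mv} v _) st′ = ⊥-elim (stable⇒¬valid {c = c} st mv v)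
    go _ {c} _ B (step {mv = mv} v _) st done st′ = ⊥-elim (stable⇒¬valid {c = c} st′ mv v)
    go (suc n) {c} {mv ∷ ms} {mv′ ∷ ms′} len B (step v r) st (step v′ r′) st′ with ≡-dec _≟_ _≟_ mv mv′
    ... | yes refl = go n (suc-injective len) (balanced-apply B v) r st r′ st′
    ... | no mv≢mv′ with valid-disjoint B v v′ mv≢mv′
    ...   | d with valid-move-occurs {mv = mv′} (balanced-apply {c} B v) (valid-after {c = c} (disjoint-sym d) v′) r st
    ...     | as , bs , refl , ds with move-to-front as ds r
    ...       | r-front@(step _ r-rest) , same =
      λ x → trans (via-mv′ x) (trans (sym (reorder x)) (rest x))
      where
      via-mv′ : exec (apply c mv) (as ++ mv′ ∷ bs) ≗ exec (apply c mv) (mv′ ∷ as ++ bs)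
      via-mv′ = go n (suc-injective len) (balanced-apply B v) r st r-front
                  (stable-≗ (λ x → sym (same x)) st)
      reorder : exec (apply (apply c mv′) mv) (as ++ bs) ≗ exec (apply (apply c mv) mv′) (as ++ bs)
      reorder = exec-≗ (as ++ bs) (apply-comm c (disjoint-sym d))
      r-swapped : Run (apply c mv′) (mv ∷ as ++ bs)
      r-swapped = step (valid-after d v) (run-≗ (apply-comm c d) r-rest)
      rest : exec (apply c mv′) (mv ∷ as ++ bs) ≗ exec (apply c mv′) ms′
      rest = go n (trans (sym (length-++-sucʳ as mv′ bs)) (suc-injective len)) (balanced-apply B v′)
               r-swapped (stable-≗ (λ x → trans (sym (same x)) (sym (reorder x))) st) r′ st′

  leftOf-step⇒at : ∀ {c} → Balanced c → ∀ i j → leftOf c j i ≡ false → leftOf c (suc j) i ≡ true → At c i j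
  leftOf-step⇒at {c} B i j out in′ with on-site B i
  ... | t , at , _ = subst (At c i) (≤-antisym (≤-pred (<ᵇ-true⁻ t<1+j)) (≮⇒≥ (<ᵇ-false⁻ t≮j))) at
    where
    t≮j = trans (sym (leftOf-at c i j at)) out
    t<1+j = trans (sym (leftOf-at c i (suc j) at)) in′

  stable⇒#left-suc-≤ : ∀ {c} → Balanced c → Stable c → ∀ j → #left c (suc j) ≤ suc (#left c j)
  stable⇒#left-suc-≤ {c} B st j with #left c (suc j) ≤? suc (#left c j)
  ... | yes ≤ = ≤
  ... | no ≰ with count-witness₂ (leftOf c j) (leftOf c (suc j)) (leftOf-mono c j) (≰⇒> ≰)
  ...   | a , b , a≢b , a-out , a-in , b-out , b-in =
    ⊥-elim (st a b a≢b (trans (leftOf-step⇒at B a j a-out a-in) (sym (leftOf-step⇒at B b j b-out b-in))))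

  stable-drops : ∀ {c} → Balanced c → Stable c → ∃[ J ] (1 ≤ J × J ≤ suc m × DropsAt (#left c) (suc m) J)
  stable-drops {c} B st =
    drops-somewhere (λ j j≤ → #left≤ B j j≤ , ≤suc-#left B j j≤) (stable⇒#left-suc-≤ B st)
      (suc m) ≤-refl (s≤s (#left-≤ c (suc m)))

  exec-avoiding : ∀ (c : Config m) {i ys} → All (Avoids i) ys → exec c ys i ≡ c i
  exec-avoiding c []                        = refl
  exec-avoiding c {ys = mv ∷ _} (av ∷ avs) = trans (exec-avoiding (apply c mv) avs) (apply-avoiding c av)

  parked-#≤-grows : ∀ {c ys i s} → Balanced c → Run c ys → At c i s → All (Avoids i) ys →
    #left c (suc s) ≤ #left (exec c ys) (suc s)
  parked-#≤-grows B done at [] = ≤-refl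
  parked-#≤-grows {c} {i = i} {s} B (step {mv = x , y} v r) at (av@(x≢i , y≢i) ∷ avs) =
    ≤-trans one-step (parked-#≤-grows (balanced-apply B v) r (trans (cong pos (apply-avoiding c av)) at) avs)
    where
    open Toppled B v
    one-step : #left c (suc s) ≤ #left c′ (suc s)
    one-step with suc s ≟ℕ suc k | suc s ≟ℕ suc (suc k)
    ... | yes refl | _      = subst₂ _≤_ (sym #left-at) (sym #left-at′) (n≤1+n k)
    ... | no _     | yes refl =
      ⊥-elim (no-three-on-site B x y i (suc k) (q≢p ∘ sym) x≢i y≢i p-at q-at at)
    ... | no s≢k   | no s≢1+k = ≤-reflexive (sym (#left-unchanged (suc s) s≢k s≢1+k))

  parked-#<-shrinks : ∀ {c ys i s} → Balanced c → Run c ys → At c i s → All (Avoids i) ys →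
    #left (exec c ys) s ≤ #left c s
  parked-#<-shrinks B done at [] = ≤-refl
  parked-#<-shrinks {c} {i = i} {s} B (step {mv = x , y} v r) at (av@(x≢i , y≢i) ∷ avs) =
    ≤-trans (parked-#<-shrinks (balanced-apply B v) r (trans (cong pos (apply-avoiding c av)) at) avs) one-step
    where
    open Toppled B v
    one-step : #left c′ s ≤ #left c s
    one-step with s ≟ℕ suc k | s ≟ℕ suc (suc k)
    ... | yes refl | _        =
      ⊥-elim (no-three-on-site B x y i (suc k) (q≢p ∘ sym) x≢i y≢i p-at q-at at)
    ... | no _     | yes refl = subst₂ _≤_ (sym #left-beyond′) (sym #left-beyond) (n≤1+n (suc k))
    ... | no s≢1+k | no s≢2+k = ≤-reflexive (#left-unchanged s s≢1+k s≢2+k)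

  last-move-direction : ∀ {c ms J} → Balanced c → Run c ms → DropsAt (#left (exec c ms)) (suc m) J →
    ∀ i → ¬ All (Avoids i) ms → ∀ {t} → At (exec c ms) i t →
    (suc t < J → LastMoveLeft i ms) × (J ≤ t → LastMoveRight i ms)
  last-move-direction B done drops i moves at = ⊥-elim (moves [])
  last-move-direction {c} {(p , q) ∷ rest} {J} B (step v r) drops i moves {t} at with all? (avoids? i) rest
  ... | no moves-later with last-move-direction (balanced-apply B v) r drops i moves-later at
  ...   | left , right = lastMoveLeft-∷ (p , q) ∘ left , lastMoveRight-∷ (p , q) ∘ right
  last-move-direction {c} {(p , q) ∷ rest} {J} B (step v r) drops i moves {t} at | yes parked =
    by-cases (i ≟ p) (i ≟ q)
    where
    open Toppled B v
    F = exec c′ rest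
    F-i : F i ≡ c′ i
    F-i = exec-avoiding c′ parked
    2+k≤1+m : suc (suc k) ≤ suc m
    2+k≤1+m = ≤-trans in-range (n≤1+n m)
    by-cases : Dec (i ≡ p) → Dec (i ≡ q) →
      (suc t < J → LastMoveLeft i ((p , q) ∷ rest)) × (J ≤ t → LastMoveRight i ((p , q) ∷ rest))
    by-cases (yes refl) _ = (λ _ → [] , q , rest , refl , parked) , λ J≤t → ⊥-elim (1+n≰n (begin
      suc (suc k)               ≡⟨ cong suc #left-at′ ⟨
      suc (#left c′ (suc k))    ≤⟨ s≤s (parked-#≤-grows (balanced-apply B v) r p-at′ parked) ⟩
      suc (#left F (suc k))     ≡⟨ proj₂ (drops (suc k) (≤-trans (n≤1+n (suc k)) 2+k≤1+m))
                                     (≤-trans J≤t (subst (_≤ suc k) (sym t≡k) (n≤1+n k))) ⟩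
      suc k                     ∎))
      where
      open ≤-Reasoning
      t≡k : t ≡ k
      t≡k = at-unique F i at (trans (cong pos F-i) p-at′)
    by-cases (no _) (yes refl) = (λ 1+t<J → ⊥-elim (1+n≰n (begin
      suc (suc k)                 ≡⟨ proj₁ (drops (suc (suc k)) 2+k≤1+m)
                                       (<-trans (n<1+n (suc (suc k))) (subst (λ z → suc z < J) t≡2+k 1+t<J)) ⟨
      #left F (suc (suc k))       ≤⟨ parked-#<-shrinks (balanced-apply B v) r q-at′ parked ⟩
      #left c′ (suc (suc k))      ≡⟨ #left-beyond′ ⟩
      suc k                       ∎))) , λ _ → [] , p , rest , refl , parked
      where
      open ≤-Reasoning
      t≡2+k : t ≡ suc (suc k)
      t≡2+k = at-unique F i at (trans (cong pos F-i) q-at′)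
    by-cases (no i≢p) (no i≢q) = ⊥-elim (moves ((i≢p ∘ sym , i≢q ∘ sym) ∷ parked))

  -- Site J − 1 is the one empty site of F.
  module FinalLabels {F : Config m} (B : Balanced F) {J : ℕ} (J≤1+m : J ≤ suc m)
    (drops : DropsAt (#left F) (suc m) J) (rid : ReadsIdentity F)
    (label-injective : ∀ i j → label (F i) ≡ label (F j) → i ≡ j)
    (label-≥1 : ∀ i → 1 ≤ label (F i)) (label-≤m : ∀ i → label (F i) ≤ m) where

    label-mono : ∀ {i j t₁ t₂} → At F i t₁ → At F j t₂ → t₁ < t₂ → label (F i) < label (F j)
    label-mono {i} {j} {t₁} {t₂} at₁ at₂ t₁<t₂ with <-cmp (label (F i)) (label (F j))
    ... | tri< lt _ _ = lt
    ... | tri≈ _ same _ with label-injective i j same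
    ...   | refl = ⊥-elim (<-irrefl (at-unique F i at₁ at₂) t₁<t₂)
    label-mono {i} {j} at₁ at₂ t₁<t₂ | tri> _ _ gt =
      ⊥-elim (ℤP.<-asym (subst₂ ℤ._<_ (sym at₁) (sym at₂) (site-mono-< t₁<t₂)) (rid j i gt))

    site-≤ : ∀ {i t} → At F i t → t ≤ m
    site-≤ {i} at with on-site B i
    ... | t , at′ , t≤m = subst (_≤ m) (at-unique F i at′ at) t≤m

    empty-site : ∀ {i t} → At F i t → suc t ≢ J
    empty-site {i} {t} at refl = 1+n≰n (begin
      suc (#left F t)    ≤⟨ count-gain i (leftOf-mono F t) (trans (leftOf-at F i t at) (<ᵇ-false (n≮n t)))
                                                          (trans (leftOf-at F i (suc t) at) (<ᵇ-true (n<1+n t))) ⟩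
      #left F (suc t)    ≡⟨ suc-injective (proj₂ (drops (suc t) (s≤s t≤m)) ≤-refl) ⟩
      t                  ≡⟨ proj₁ (drops t (≤-trans t≤m (n≤1+n m))) (n<1+n t) ⟨
      #left F t          ∎)
      where
      open ≤-Reasoning
      t≤m = site-≤ at

    occupied : ∀ t → t ≤ m → suc t ≢ J → ∃[ i ] At F i t
    occupied t t≤m 1+t≢J with count-witness (leftOf F t) (leftOf F (suc t)) more
      where
      more : #left F t < #left F (suc t)
      more with suc t <? J
      ... | yes 1+t<J = subst₂ _<_ (sym (proj₁ (drops t (≤-trans t≤m (n≤1+n m))) (<-trans (n<1+n t) 1+t<J)))
                                   (sym (proj₁ (drops (suc t) (s≤s t≤m)) 1+t<J)) (n<1+n t)
      ... | no 1+t≮J = subst (#left F t <_) (trans e₁ (sym (suc-injective e₂))) (n<1+n _)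
        where
        J≤t : J ≤ t
        J≤t = ≤-pred (≤∧≢⇒< (≮⇒≥ 1+t≮J) (1+t≢J ∘ sym))
        e₁ = proj₂ (drops t (≤-trans t≤m (n≤1+n m))) J≤t
        e₂ = proj₂ (drops (suc t) (s≤s t≤m)) (≤-trans J≤t (n≤1+n t))
    ... | i , out , in′ = i , leftOf-step⇒at B i t out in′

    private
      LowerBound : ℕ → Set
      LowerBound t = ∀ {i} → At F i t → (suc t < J → suc t ≤ label (F i)) × (J ≤ t → t ≤ label (F i))

      lower₀ : LowerBound 0
      lower₀ {i} _ = (λ _ → label-≥1 i) , λ _ → z≤n

      lower₁ : LowerBound 1
      lower₁ {i} at = (λ 2<J → let j , at₀ = occupied 0 z≤n (λ 1≡J → <-irrefl 1≡J (<-trans (n<1+n 1) 2<J))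
                                in ≤-trans (s≤s (label-≥1 j)) (label-mono at₀ at (n<1+n 0)))
                    , λ _ → label-≥1 i

      lower₂ : ∀ t → LowerBound t → LowerBound (suc t) → LowerBound (suc (suc t))
      lower₂ t low₀ low₁ {i} at = left , right
        where
        2+t≤m : suc (suc t) ≤ m
        2+t≤m = site-≤ at
        1+t≤m = ≤-trans (n≤1+n _) 2+t≤m
        left : suc (suc (suc t)) < J → suc (suc (suc t)) ≤ label (F i)
        left 3+t<J with occupied (suc t) 1+t≤m (λ e → <-irrefl e (<-trans (n<1+n _) 3+t<J))
        ... | j , at₁ = ≤-trans (s≤s (proj₁ (low₁ at₁) (<-trans (n<1+n _) 3+t<J))) (label-mono at₁ at (n<1+n _))
        right : J ≤ suc (suc t) → suc (suc t) ≤ label (F i)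
        right J≤2+t with J ≤? suc t
        ... | yes J≤1+t with occupied (suc t) 1+t≤m (λ e → 1+n≰n (subst (_≤ suc t) (sym e) J≤1+t))
        ...   | j , at₁ = ≤-trans (s≤s (proj₂ (low₁ at₁) J≤1+t)) (label-mono at₁ at (n<1+n _))
        right J≤2+t | no J≰1+t with ≤-antisym J≤2+t (≰⇒> J≰1+t)
        ...   | refl with occupied t (≤-trans (n≤1+n _) 1+t≤m) (λ e → J≰1+t (≤-reflexive (sym e)))
        ...     | j , at₀ = ≤-trans (s≤s (proj₁ (low₀ at₀) (n<1+n _))) (label-mono at₀ at (<-trans (n<1+n t) (n<1+n _)))

      lower : ∀ t → LowerBound t × LowerBound (suc t)
      lower zero    = lower₀ , lower₁
      lower (suc t) = let low₀ , low₁ = lower t in low₁ , lower₂ t low₀ low₁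

      UpperBound : ℕ → Set
      UpperBound d = ∀ {i t} → t + d ≡ m → At F i t → (suc t < J → label (F i) ≤ suc t) × (J ≤ t → label (F i) ≤ t)

      upper₀ : UpperBound 0
      upper₀ {i} {t} t+0≡m _ rewrite +-identityʳ t =
        (λ 1+t<J → ⊥-elim (≤⇒≯ J≤1+m (subst (λ z → suc z < J) t+0≡m 1+t<J))) ,
        λ _ → subst (label (F i) ≤_) (sym t+0≡m) (label-≤m i)

      upper₁ : UpperBound 1
      upper₁ {i} {t} t+1≡m at = (λ _ → subst (label (F i) ≤_) (sym 1+t≡m) (label-≤m i)) , right
        where
        1+t≡m : suc t ≡ m
        1+t≡m = trans (+-comm 1 t) t+1≡m
        right : J ≤ t → label (F i) ≤ t
        right J≤t with occupied (suc t) (≤-reflexive 1+t≡m) (λ e → 1+n≰n (≤-trans (n≤1+n _) (subst (_≤ t) (sym e) J≤t)))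
        ... | j , at₁ = ≤-pred (≤-trans (label-mono at at₁ (n<1+n t))
                                 (proj₂ (upper₀ (trans (+-identityʳ _) 1+t≡m) at₁) (≤-trans J≤t (n≤1+n t))))

      upper₂ : ∀ d → UpperBound d → UpperBound (suc d) → UpperBound (suc (suc d))
      upper₂ d up₀ up₁ {i} {t} t+2+d≡m at = left , right
        where
        e₁ : suc t + suc d ≡ m
        e₁ = trans (sym (+-suc t (suc d))) t+2+d≡m
        e₂ : suc (suc t) + d ≡ m
        e₂ = trans (sym (+-suc (suc t) d)) e₁
        1+t≤m : suc t ≤ m
        1+t≤m = subst (suc t ≤_) e₁ (m≤m+n (suc t) (suc d))
        2+t≤m : suc (suc t) ≤ m
        2+t≤m = subst (suc (suc t) ≤_) e₂ (m≤m+n _ d)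
        left : suc t < J → label (F i) ≤ suc t
        left 1+t<J with suc (suc t) <? J
        ... | yes 2+t<J with occupied (suc t) 1+t≤m (λ e → <-irrefl e 2+t<J)
        ...   | j , at₁ = ≤-pred (≤-trans (label-mono at at₁ (n<1+n t)) (proj₁ (up₁ e₁ at₁) 2+t<J))
        left 1+t<J | no 2+t≮J with ≤-antisym (≮⇒≥ 2+t≮J) 1+t<J
        ...   | refl with occupied (suc (suc t)) 2+t≤m (λ e → <-irrefl (sym e) (n<1+n _))
        ...     | j , at₂ = ≤-pred (≤-trans (label-mono at at₂ (<-trans (n<1+n t) (n<1+n _)))
                                            (proj₂ (up₀ e₂ at₂) ≤-refl))
        right : J ≤ t → label (F i) ≤ t
        right J≤t with occupied (suc t) 1+t≤m (λ e → 1+n≰n (≤-trans (n≤1+n _) (subst (_≤ t) (sym e) J≤t)))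
        ... | j , at₁ = ≤-pred (≤-trans (label-mono at at₁ (n<1+n t)) (proj₂ (up₁ e₁ at₁) (≤-trans J≤t (n≤1+n t))))

      upper : ∀ d → UpperBound d × UpperBound (suc d)
      upper zero    = upper₀ , upper₁
      upper (suc d) = let up₀ , up₁ = upper d in up₁ , upper₂ d up₀ up₁

    label-at : ∀ {i t} → At F i t → (suc t < J → label (F i) ≡ suc t) × (J ≤ t → label (F i) ≡ t)
    label-at {i} {t} at =
      (λ 1+t<J → ≤-antisym (proj₁ (up at) 1+t<J) (proj₁ (low at) 1+t<J)) ,
      (λ J≤t → ≤-antisym (proj₂ (up at) J≤t) (proj₂ (low at) J≤t))
      where
      low = proj₁ (lower t)
      up = proj₁ (upper (m ∸ t)) (m+[n∸m]≡n (site-≤ at))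

  -- Σ_{j ≤ m} #left c j = Σ_chips (m − site), and a move preserves the sum of sites.
  potential : Config m → ℕ
  potential c = sum< (suc m) (#left c)

  potential-exec : ∀ {c ms} → Balanced c → Run c ms → potential (exec c ms) ≡ potential c
  potential-exec B done = refl
  potential-exec {c} B (step {mv = p , q} v r) = trans (potential-exec (balanced-apply B v) r) one-step
    where
    open Toppled B v
    one-step : potential c′ ≡ potential c
    one-step = sum<-transfer (suc k) (trans #left-at′ (cong suc (sym #left-at)))
                 (trans (cong suc #left-beyond′) (sym #left-beyond))
                 #left-unchanged (suc m) (s≤s in-range)

-- The initial configuration

relabel-cases : ∀ r v → (v < r × relabel r v ≡ v) ⊎ (r ≤ v × relabel r v ≡ suc v)
relabel-cases r v with v <ᵇ r in v<ᵇr
... | true  = inj₁ (<ᵇ-true⁻ v<ᵇr , refl)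
... | false = inj₂ (≮⇒≥ (<ᵇ-false⁻ v<ᵇr) , refl)

relabel-≢ : ∀ r v → relabel r v ≢ r
relabel-≢ r v e with relabel-cases r v
... | inj₁ (v<r , same) = <-irrefl (trans (sym same) e) v<r
... | inj₂ (r≤v , up)   = 1+n≰n (subst (_≤ v) (trans (sym e) up) r≤v)

relabel-injective : ∀ r v w → relabel r v ≡ relabel r w → v ≡ w
relabel-injective r v w e with relabel-cases r v | relabel-cases r w
... | inj₁ (_ , eq₁)    | inj₁ (_ , eq₂)    = trans (sym eq₁) (trans e eq₂)
... | inj₂ (_ , eq₁)    | inj₂ (_ , eq₂)    = suc-injective (trans (sym eq₁) (trans e eq₂))
... | inj₁ (v<r , eq₁)  | inj₂ (r≤w , eq₂)  =
  ⊥-elim (<-irrefl refl (<-≤-trans (subst (_< r) (trans (sym eq₁) (trans e eq₂)) v<r) (m≤n⇒m≤1+n r≤w)))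
... | inj₂ (r≤v , eq₁)  | inj₁ (w<r , eq₂)  =
  ⊥-elim (<-irrefl refl (<-≤-trans (subst (_< r) (trans (sym eq₂) (trans (sym e) eq₁)) w<r) (m≤n⇒m≤1+n r≤v)))

relabel-range : ∀ r v n → 1 ≤ v → v ≤ n → 1 ≤ relabel r v × relabel r v ≤ suc n
relabel-range r v n 1≤v v≤n with relabel-cases r v
... | inj₁ (_ , eq) = subst (1 ≤_) (sym eq) 1≤v , subst (_≤ suc n) (sym eq) (m≤n⇒m≤1+n v≤n)
... | inj₂ (_ , eq) = subst (1 ≤_) (sym eq) (s≤s z≤n) , subst (_≤ suc n) (sym eq) (s≤s v≤n)

module Initial (n : ℕ) (1≤n : 1 ≤ n) (π : Permutation′ n) (r : ℕ) where

  a : ℕ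
  a = suc ((n ∸ 1) / 2)

  -- Sites are numbered from position −a, so that the origin is site a and the
  -- chips of π start on sites 1 … n.
  open Sites (suc n) (- (+ a)) public

  c₀ : Config (suc n)
  c₀ = initial n π r

  a≤n : a ≤ n
  a≤n = subst (a ≤_) (trans (+-comm 1 (n ∸ 1)) (m∸n+n≡m 1≤n)) (s≤s (m/n≤m (n ∸ 1) 2))

  site₀ : Fin (suc n) → ℕ
  site₀ zero    = a
  site₀ (suc t) = suc (toℕ t)

  at-site₀ : ∀ i → At c₀ i (site₀ i)
  at-site₀ zero    = sym (ℤP.+-inverseˡ (+ a))
  at-site₀ (suc t) = sym (shift-origin (+ ((n ∸ 1) / 2)) (+ toℕ t))
    where
    shift-origin : ∀ B T → - (+ 1 ℤ.+ B) ℤ.+ (+ 1 ℤ.+ T) ≡ - B ℤ.+ T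
    shift-origin = ℤSolver.solve-∀

  site₀-range : ∀ i → 1 ≤ site₀ i × site₀ i ≤ n
  site₀-range zero    = s≤s z≤n , a≤n
  site₀-range (suc t) = s≤s z≤n , toℕ<n t

  #left₀ : ∀ j → #left c₀ j ≡ bit (a <ᵇ j) + n ⊓ (j ∸ 1)
  #left₀ j = cong₂ _+_ (cong bit (leftOf-at c₀ zero j (at-site₀ zero)))
    (trans (count-cong (λ t → trans (leftOf-at c₀ (suc t) j (at-site₀ (suc t))) (suc<ᵇ (toℕ t) j)))
           (count-toℕ< n (j ∸ 1)))

  balanced₀ : Balanced c₀
  balanced₀ = record { on-site = on-site₀ ; #left≤ = #left≤₀ ; ≤suc-#left = ≤suc-#left₀ }
    where
    on-site₀ : ∀ i → ∃[ t ] (At c₀ i t × t ≤ suc n)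
    on-site₀ i = site₀ i , at-site₀ i , m≤n⇒m≤1+n (proj₂ (site₀-range i))
    #left≤₀ : ∀ j → j ≤ suc (suc n) → #left c₀ j ≤ j
    #left≤₀ zero    _ rewrite #left₀ zero = m⊓n≤n n 0
    #left≤₀ (suc j) _ rewrite #left₀ (suc j) = +-mono-≤ (bit≤1 (a <ᵇ suc j)) (m⊓n≤n n j)
      where
      bit≤1 : ∀ x → bit x ≤ 1
      bit≤1 true  = ≤-refl
      bit≤1 false = z≤n
    ≤suc-#left₀ : ∀ j → j ≤ suc (suc n) → j ≤ suc (#left c₀ j)
    ≤suc-#left₀ zero    _ = z≤n
    ≤suc-#left₀ (suc j) j≤ rewrite #left₀ (suc j) with j ≤? n
    ... | yes j≤n rewrite m≥n⇒m⊓n≡n j≤n = s≤s (m≤n+m j _)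
    ... | no j≰n with ≤-antisym (≤-pred j≤) (≰⇒> j≰n)
    ...   | refl rewrite <ᵇ-true (s≤s (m≤n⇒m≤1+n a≤n)) | m≤n⇒m⊓n≡m (n≤1+n n) = ≤-refl

  potential₀ : potential c₀ ≡ (suc n ∸ a) + sum< (suc (suc n)) (λ j → j ∸ 1)
  potential₀ = trans (sum<-cong (suc (suc n)) (λ j j< → trans (#left₀ j)
                        (cong (λ x → bit (a <ᵇ j) + x) (m≥n⇒m⊓n≡n (j∸1≤n j j<)))))
                     (sum<-indicator (suc (suc n)) a (λ j → j ∸ 1))
    where
    j∸1≤n : ∀ j → j < suc (suc n) → j ∸ 1 ≤ n
    j∸1≤n zero    _   = z≤n
    j∸1≤n (suc j) j<  = ≤-pred (≤-pred j<)

  label₀-range : 1 ≤ r → r ≤ suc n → ∀ i → 1 ≤ label (c₀ i) × label (c₀ i) ≤ suc n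
  label₀-range 1≤r r≤1+n zero    = 1≤r , r≤1+n
  label₀-range 1≤r r≤1+n (suc t) = relabel-range r (suc (toℕ (π ⟨$⟩ʳ t))) n (s≤s z≤n) (toℕ<n (π ⟨$⟩ʳ t))

  label₀-injective : ∀ i j → label (c₀ i) ≡ label (c₀ j) → i ≡ j
  label₀-injective zero    zero    _ = refl
  label₀-injective zero    (suc t) e = ⊥-elim (relabel-≢ r _ (sym e))
  label₀-injective (suc t) zero    e = ⊥-elim (relabel-≢ r _ e)
  label₀-injective (suc t) (suc u) e =
    cong suc (trans (sym (inverseˡ π)) (trans (cong (π ⟨$⟩ˡ_) π-t≡π-u) (inverseˡ π)))
    where
    π-t≡π-u : π ⟨$⟩ʳ t ≡ π ⟨$⟩ʳ u
    π-t≡π-u = toℕ-injective (suc-injective (relabel-injective r _ _ e))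

-- Stable runs from the initial configuration

module StableRun (n : ℕ) (1≤n : 1 ≤ n) (π : Permutation′ n) (r : ℕ) (1≤r : 1 ≤ r) (r≤1+n : r ≤ suc n)
  (toppleable : Toppleable n π r)
  (ms : List (Move (suc n))) (run : Run (initial n π r) ms) (stable : Stable (exec (initial n π r) ms)) where

  open Initial n 1≤n π r
  open Balanced

  F : Config (suc n)
  F = exec c₀ ms

  balanced-F : Balanced F
  balanced-F = balanced-exec balanced₀ run

  reads-identity : ReadsIdentity F
  reads-identity =
    let _ , run′ , stable′ , id′ = toppleable
    in readsIdentity-≗ (λ i → sym (confluent balanced₀ run stable run′ stable′ i)) id′

  label-F : ∀ i → label (F i) ≡ label (c₀ i)
  label-F = label-exec c₀ ms

  drop-of-F : ∃[ J ] (1 ≤ J × J ≤ suc (suc n) × DropsAt (#left F) (suc (suc n)) J)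
  drop-of-F = stable-drops balanced-F stable

  J : ℕ
  J = proj₁ drop-of-F

  1≤J : 1 ≤ J
  1≤J = proj₁ (proj₂ drop-of-F)

  J≤2+n : J ≤ suc (suc n)
  J≤2+n = proj₁ (proj₂ (proj₂ drop-of-F))

  drops : DropsAt (#left F) (suc (suc n)) J
  drops = proj₂ (proj₂ (proj₂ drop-of-F))

  open FinalLabels balanced-F J≤2+n drops reads-identity
    (λ i j e → label₀-injective i j (trans (sym (label-F i)) (trans e (label-F j))))
    (λ i → subst (1 ≤_) (sym (label-F i)) (proj₁ (label₀-range 1≤r r≤1+n i)))
    (λ i → subst (_≤ suc n) (sym (label-F i)) (proj₂ (label₀-range 1≤r r≤1+n i)))

  h : ℕ
  h = J ∸ 1

  J≡1+h : J ≡ suc h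
  J≡1+h = sym (trans (+-comm 1 h) (m∸n+n≡m 1≤J))

  -- The potential falls short of Σ_{j ≤ n+1} j by a initially, and by
  -- (n + 1) − h in F, whose empty site is h.
  h+a≡1+n : h + a ≡ suc n
  h+a≡1+n = ∸+∸≡⇒+≡ (≤-pred (subst (_≤ suc (suc n)) J≡1+h J≤2+n)) (m≤n⇒m≤1+n a≤n)
    (+-cancelʳ-≡ X _ _ (begin
      (suc n ∸ h) + (suc n ∸ a) + X     ≡⟨ +-assoc (suc n ∸ h) _ X ⟩
      (suc n ∸ h) + ((suc n ∸ a) + X)   ≡⟨ cong (λ x → (suc n ∸ h) + x) potential₀ ⟨
      (suc n ∸ h) + potential c₀        ≡⟨ cong (λ x → (suc n ∸ h) + x) (potential-exec balanced₀ run) ⟨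
      (suc n ∸ h) + potential F         ≡⟨ sum<-indicator (suc (suc n)) h (#left F) ⟨
      sum< (suc (suc n)) (λ j → bit (h <ᵇ j) + #left F j) ≡⟨ sum<-cong (suc (suc n)) (λ j j< → sym (id-via-F j j<)) ⟩
      sum< (suc (suc n)) (λ j → j)     ≡⟨ sum<-cong (suc (suc n)) (λ j _ → id-via-pred j) ⟩
      sum< (suc (suc n)) (λ j → bit (0 <ᵇ j) + (j ∸ 1)) ≡⟨ sum<-indicator (suc (suc n)) 0 (λ j → j ∸ 1) ⟩
      suc n + X                          ∎))
    where
    open ≡-Reasoning
    X = sum< (suc (suc n)) (λ j → j ∸ 1)
    id-via-pred : ∀ j → j ≡ bit (0 <ᵇ j) + (j ∸ 1)
    id-via-pred zero    = refl
    id-via-pred (suc j) = refl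
    id-via-F : ∀ j → j < suc (suc n) → j ≡ bit (h <ᵇ j) + #left F j
    id-via-F j j< with h <? j
    ... | yes h<j = trans (sym (proj₂ (drops j (<⇒≤ j<)) (subst (_≤ j) (sym J≡1+h) h<j)))
                          (cong (λ b → bit b + #left F j) (sym (<ᵇ-true h<j)))
    ... | no h≮j  = trans (sym (proj₁ (drops j (<⇒≤ j<)) (subst (j <_) (sym J≡1+h) (s≤s (≮⇒≥ h≮j)))))
                          (cong (λ b → bit b + #left F j) (sym (<ᵇ-false h≮j)))

  h≡1+n/2 : h ≡ suc (n / 2)
  h≡1+n/2 = complement-of-half n 1≤n h h+a≡1+n

  J≡n/2+2 : J ≡ n / 2 + 2
  J≡n/2+2 = trans J≡1+h (trans (cong suc h≡1+n/2) (+-comm 2 (n / 2)))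

  a≤h : a ≤ h
  a≤h = subst (a ≤_) (sym h≡1+n/2) (s≤s (proj₁ (half-pred-bounds n 1≤n)))

  h≤1+a : h ≤ suc a
  h≤1+a = subst (_≤ suc a) (sym h≡1+n/2) (s≤s (proj₂ (half-pred-bounds n 1≤n)))

  -- A chip that never moves keeps its site s, which bounds #left F s from above
  -- and #left F (s + 1) from below; since a ≤ h ≤ a + 1 no site s survives.
  every-chip-moves : ∀ i → ¬ All (Avoids i) ms
  every-chip-moves i parked = impossible (<-cmp s h)
    where
    s = site₀ i
    1≤s = proj₁ (site₀-range i)
    s≤n = proj₂ (site₀-range i)
    a<s : s ≤ h → a < s
    a<s s≤h with a <? s
    ... | yes a<s = a<s
    ... | no a≮s = ⊥-elim (<⇒≱ (∸-monoʳ-< (s≤s z≤n) 1≤s) (begin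
      s                          ≡⟨ proj₁ (drops s (m≤n⇒m≤1+n (m≤n⇒m≤1+n s≤n))) (subst (s <_) (sym J≡1+h) (s≤s s≤h)) ⟨
      #left F s                  ≤⟨ parked-#<-shrinks {i = i} {s} balanced₀ run (at-site₀ i) parked ⟩
      #left c₀ s                 ≡⟨ #left₀ s ⟩
      bit (a <ᵇ s) + n ⊓ (s ∸ 1) ≡⟨ cong₂ (λ b x → bit b + x) (<ᵇ-false a≮s) (m≥n⇒m⊓n≡n (≤-trans (m∸n≤m s 1) s≤n)) ⟩
      s ∸ 1                      ∎))
      where open ≤-Reasoning
    s<a : h ≤ s → s < a
    s<a h≤s with a <? suc s
    ... | no a≮1+s = ≮⇒≥ a≮1+s
    ... | yes a<1+s = ⊥-elim (1+n≰n (begin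
      suc s                          ≡⟨ cong₂ (λ b x → bit b + x) (<ᵇ-true a<1+s) (m≥n⇒m⊓n≡n s≤n) ⟨
      bit (a <ᵇ suc s) + n ⊓ s       ≡⟨ #left₀ (suc s) ⟨
      #left c₀ (suc s)               ≤⟨ parked-#≤-grows {i = i} {s} balanced₀ run (at-site₀ i) parked ⟩
      #left F (suc s)                ≡⟨ suc-injective (proj₂ (drops (suc s) (s≤s (m≤n⇒m≤1+n s≤n)))
                                         (subst (_≤ suc s) (sym J≡1+h) (s≤s h≤s))) ⟩
      s                              ∎))
      where open ≤-Reasoning
    impossible : Tri (s < h) (s ≡ h) (h < s) → ⊥
    impossible (tri< s<h _ _) = <⇒≱ (<-≤-trans (s≤s (a<s (<⇒≤ s<h))) s<h) h≤1+a
    impossible (tri≈ _ s≡h _) = <-asym (a<s (≤-reflexive s≡h)) (s<a (≤-reflexive (sym s≡h)))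
    impossible (tri> _ _ h<s) = <⇒≱ (<-trans h<s (s<a (<⇒≤ h<s))) a≤h

  right-of-empty-site : ∀ {i t} → At F i t → ¬ suc t < J → J ≤ t
  right-of-empty-site at 1+t≮J = ≤-pred (≤∧≢⇒< (≮⇒≥ 1+t≮J) (empty-site at ∘ sym))

  last-move-left : ∀ i → label (c₀ i) ≤ n / 2 + 1 → LastMoveLeft i ms
  last-move-left i label≤ with on-site balanced-F i
  ... | t , at , _ with suc t <? J
  ...   | yes 1+t<J = proj₁ (last-move-direction balanced₀ run drops i (every-chip-moves i) at) 1+t<J
  ...   | no 1+t≮J  = ⊥-elim (1+n≰n (subst (_≤ n / 2 + 1) (+-suc (n / 2) 1) (begin
    n / 2 + 2         ≡⟨ J≡n/2+2 ⟨
    J                 ≤⟨ J≤t ⟩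
    t                 ≡⟨ proj₂ (label-at at) J≤t ⟨
    label (F i)       ≡⟨ label-F i ⟩
    label (c₀ i)      ≤⟨ label≤ ⟩
    n / 2 + 1         ∎)))
    where
    open ≤-Reasoning
    J≤t = right-of-empty-site at 1+t≮J

  last-move-right : ∀ i → n / 2 + 2 ≤ label (c₀ i) → LastMoveRight i ms
  last-move-right i label≥ with on-site balanced-F i
  ... | t , at , _ with suc t <? J
  ...   | no 1+t≮J  = proj₂ (last-move-direction balanced₀ run drops i (every-chip-moves i) at)
                        (right-of-empty-site at 1+t≮J)
  ...   | yes 1+t<J = ⊥-elim (<-irrefl refl (begin-strict
    n / 2 + 2         ≤⟨ label≥ ⟩
    label (c₀ i)      ≡⟨ label-F i ⟨
    label (F i)       ≡⟨ proj₁ (label-at at) 1+t<J ⟩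
    suc t             <⟨ 1+t<J ⟩
    J                 ≡⟨ J≡n/2+2 ⟩
    n / 2 + 2         ∎))
    where open ≤-Reasoning

  last-move : ∃[ xs ] ∃[ p ] ∃[ q ]
    (ms ≡ xs ++ [ (p , q) ] × label (c₀ p) ≡ n / 2 + 1 × label (c₀ q) ≡ n / 2 + 2)
  last-move with split-last ms (λ ms≡[] → every-chip-moves zero (subst (All (Avoids zero)) (sym ms≡[]) []))
  ... | xs , (p , q) , ms≡ with run-++⁻ xs (subst (Run c₀) ms≡ run)
  ...   | run-xs , step v done = xs , p , q , ms≡ , label-p , label-q
    where
    open Toppled (balanced-exec balanced₀ run-xs) v
    F≡c′ : F ≡ c′
    F≡c′ = trans (cong (exec c₀) ms≡) (exec-++ c₀ xs [ (p , q) ])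
    #left-F-at : #left F (suc k) ≡ suc k
    #left-F-at = trans (cong (λ z → #left z (suc k)) F≡c′) #left-at′
    #left-F-beyond : #left F (suc (suc k)) ≡ suc k
    #left-F-beyond = trans (cong (λ z → #left z (suc (suc k))) F≡c′) #left-beyond′
    1+k<J : suc k < J
    1+k<J with suc k <? J
    ... | yes 1+k<J = 1+k<J
    ... | no 1+k≮J  = ⊥-elim (1+n≰n (≤-reflexive
      (trans (cong suc (sym #left-F-at)) (proj₂ (drops (suc k) (≤-trans (n≤1+n _) (≤-trans in-range (n≤1+n _))))
                                                  (≮⇒≥ 1+k≮J)))))
    J≤2+k : J ≤ suc (suc k)
    J≤2+k with suc (suc k) <? J
    ... | no 2+k≮J  = ≮⇒≥ 2+k≮J
    ... | yes 2+k<J = ⊥-elim (1+n≰n (≤-reflexive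
      (sym (trans (sym #left-F-beyond) (proj₁ (drops (suc (suc k)) (≤-trans in-range (n≤1+n _))) 2+k<J)))))
    2+k≡ : suc (suc k) ≡ n / 2 + 2
    2+k≡ = trans (≤-antisym 1+k<J J≤2+k) J≡n/2+2
    label-p : label (c₀ p) ≡ n / 2 + 1
    label-p = trans (sym (label-F p))
      (trans (proj₁ (label-at (trans (cong (λ z → pos (z p)) F≡c′) p-at′)) 1+k<J)
             (suc-injective (trans 2+k≡ (+-suc (n / 2) 1))))
    label-q : label (c₀ q) ≡ n / 2 + 2
    label-q = trans (sym (label-F q))
      (trans (proj₂ (label-at (trans (cong (λ z → pos (z q)) F≡c′) q-at′)) J≤2+k) 2+k≡)

lemma3p2 : (n : ℕ) → 2 ≤ n → (r : ℕ) → 1 ≤ r → r ≤ suc n →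
    (π : Permutation′ n) → Toppleable n π r →
    (ms : List (Move (suc n))) → Run (initial n π r) ms →
    Stable (exec (initial n π r) ms) →
      ((i : Fin (suc n)) → 1 ≤ label (initial n π r i) →
        label (initial n π r i) ≤ n / 2 + 1 → LastMoveLeft i ms)
      × ((i : Fin (suc n)) → n / 2 + 2 ≤ label (initial n π r i) →
        label (initial n π r i) ≤ suc n → LastMoveRight i ms)
      × Σ (List (Move (suc n))) (λ xs → Σ (Fin (suc n)) λ p → Σ (Fin (suc n)) λ q →
          ms ≡ xs ++ [ (p , q) ]
          × label (initial n π r p) ≡ n / 2 + 1
          × label (initial n π r q) ≡ n / 2 + 2)
lemma3p2 n 2≤n r 1≤r r≤1+n π toppleable ms run stable =
  (λ i _ → last-move-left i) , (λ i label≥ _ → last-move-right i label≥) , last-move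
  where open StableRun n (<⇒≤ 2≤n) π r 1≤r r≤1+n toppleable ms run stable
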